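{- Let $N$ be a natural number, $P=\{a\subseteq N:|a|\geq 2\}$, and $E=\{e\subseteq N: |e|=2\}$. For $A\subseteq P$ let \[\mathcal E_A=\{E'\subseteq E: (\forall e\in E')(\exists p\in A)\, e\subseteq p \ \text{ and }\ (\forall p\in A)(\exists e\in E')\, e\subseteq p\}.\] Then for every $A\subseteq P$, $\|A\|_3=\min\{\|E'\|_3: E'\in\mathcal E_A\}$.
   Context: $N$ is identified with $\{0,\ldots,N-1\}$. For $A\subseteq P$ and $z\subseteq N$ let $A\restriction z=\{a\in A: a\subseteq z\}$. The graph coloring norm is defined recursively: $\|A\|_3\geq 0$ always; $\|A\|_3\geq 1$ iff $A\neq\emptyset$; for $n\geq 1$, $\|A\|_3\geq n+1$ iff for every $z\subseteq N$, either $\|A\restriction z\|_3\geq n$ or $\|A\restriction (N\setminus z)\|_3\geq n$; $\|A\|_3=n$ means $\|A\|_3\geq n$ but not $\|A\|_3\geq n+1$. -}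

module Defs where

open import Data.Nat using (ℕ; zero; suc; _≤_)
open import Data.Bool using (Bool; true; false; _∧_)
open import Data.Unit using (⊤)
open import Data.Sum using (_⊎_)
open import Data.Product using (Σ; ∃; _×_)
open import Relation.Binary.PropositionalEquality using (_≡_)
open import Relation.Nullary.Decidable using (⌊_⌋)
open import Data.Fin.Subset using (Subset; _⊆_; ∁; ∣_∣)
open import Data.Fin.Subset.Properties using (_⊆?_)

Family : ℕ → Set
Family N = Subset N → Bool

_∈F_ : ∀ {N} → Subset N → Family N → Set
a ∈F A = A a ≡ true

_⊆F_ : ∀ {N} → Family N → Family N → Set
A ⊆F B = ∀ a → a ∈F A → a ∈F B

InP : ∀ {N} → Subset N → Set
InP a = 2 ≤ ∣ a ∣

InE : ∀ {N} → Subset N → Set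
InE e = ∣ e ∣ ≡ 2

FamSubP : ∀ {N} → Family N → Set
FamSubP A = ∀ a → a ∈F A → InP a

FamSubE : ∀ {N} → Family N → Set
FamSubE E' = ∀ e → e ∈F E' → InE e

_↾_ : ∀ {N} → Family N → Subset N → Family N
(A ↾ z) a = A a ∧ ⌊ a ⊆? z ⌋

NormGE : ∀ {N} → ℕ → Family N → Set
NormGE zero A = ⊤
NormGE (suc zero) A = ∃ λ a → a ∈F A
NormGE (suc (suc n)) A = ∀ z → NormGE (suc n) (A ↾ z) ⊎ NormGE (suc n) (A ↾ ∁ z)

NormIs : ∀ {N} → Family N → ℕ → Set
NormIs A n = NormGE n A × (NormGE (suc n) A → Data.Empty.⊥)
  where import Data.Empty

InCalE : ∀ {N} → Family N → Family N → Set
InCalE A E' =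
  FamSubE E'
  × (∀ e → e ∈F E' → ∃ λ p → p ∈F A × e ⊆ p)
  × (∀ p → p ∈F A → ∃ λ e → e ∈F E' × e ⊆ p)

-- Write E ⊑ A when every member of A contains a member of E.  Then ‖A‖₃ ≥ n implies ‖E‖₃ ≥ n,
-- since E ⊑ A survives restriction to any z; every E' ∈ 𝓔_A satisfies E' ⊑ A, so ‖A‖₃ ≤ ‖E'‖₃.
-- Conversely, if ‖A‖₃ < n + 1 some z splits A into halves of norm < n; by induction they have
-- edge families of norm < n, and adding the edges of members of A that cross z gives an
-- E' ∈ 𝓔_A whose restrictions to z and ∁ z are those two families, so ‖E'‖₃ < n + 1.
module Submission where

open import Defs
open import Data.Nat using (ℕ; zero; suc; _≤_; _+_; _≤′_; ≤′-reflexive; ≤′-step; z≤n; s≤s)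
open import Data.Nat.Properties using (≤-trans; ≤-reflexive; ≤-antisym; ≮⇒≥; ≤⇒≤′; +-monoʳ-≤; +-suc; n≤1+n)
import Data.Nat.Properties as ℕ
open import Data.Bool using (true; false)
import Data.Bool.Properties as Bool
open import Data.Unit using (tt)
open import Data.Empty using (⊥-elim)
open import Data.Sum using (_⊎_; inj₁; inj₂)
open import Data.Product using (Σ; ∃; _×_; _,_; proj₁; proj₂)
open import Data.Vec using ([]; _∷_)
open import Data.Fin using (Fin)
open import Data.Fin.Properties using (¬∀⟶∃¬)
open import Data.List using (List; []; _∷_; length; allFin)
open import Data.List.Membership.Propositional using () renaming (_∈_ to _∈L_)
open import Data.List.Membership.Propositional.Properties using (∈-allFin)
open import Data.List.Relation.Unary.Any using (here; there)
open import Data.Fin.Subset using (Subset; inside; outside; _⊆_; _⊂_; ∁; ∣_∣; _∈_; _∉_; ⁅_⁆; _∪_) renaming (⊥ to ∅)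
open import Data.Fin.Subset.Properties
  using (_⊆?_; _∈?_; anySubset?; p⊆q⇒∣p∣≤∣q∣; p⊂q⇒∣p∣<∣q∣; p⊆p∪q; ∣⊥∣≡0; ∣⁅x⁆∣≡1;
         x∈⁅x⁆; x∈⁅y⁆⇒x≡y; x∈p∪q⁻; x∈p∪q⁺; x∈∁p⇒x∉p; x∉∁p⇒x∈p)
open import Relation.Binary.PropositionalEquality using (_≡_; refl; sym; subst)
open import Relation.Nullary using (¬_; Dec; yes; no; ¬?; contradiction)
open import Relation.Nullary.Decidable using (⌊_⌋; _⊎-dec_; _×-dec_; _→-dec_; decidable-stable)
open import Relation.Unary using (Decidable)

private
  variable
    N m n : ℕ
    A B E : Family N
    a e p s z : Subset N

∃-boundary : {P : ℕ → Set} → (∀ n → Dec (P n)) → P 0 → ∀ k → ¬ P k →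
  ∃ λ n → P n × ¬ P (suc n)
∃-boundary P? P0 zero ¬P0 = contradiction P0 ¬P0
∃-boundary P? P0 (suc k) ¬Pk+1 with P? k
... | yes Pk = k , Pk , ¬Pk+1
... | no ¬Pk = ∃-boundary P? P0 k ¬Pk

module _ {P : Subset N → Set} (P? : Decidable P) where

  ∄¬⇒∀ : ¬ (∃ λ z → ¬ P z) → ∀ z → P z
  ∄¬⇒∀ ∄¬P z = decidable-stable (P? z) (λ ¬Pz → ∄¬P (z , ¬Pz))

  allSubset? : Dec (∀ z → P z)
  allSubset? with anySubset? (λ z → ¬? (P? z))
  ... | yes (z , ¬Pz) = no λ ∀P → ¬Pz (∀P z)
  ... | no ∄¬P = yes (∄¬⇒∀ ∄¬P)

  ¬∀⇒∃¬ : ¬ (∀ z → P z) → ∃ λ z → ¬ P z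
  ¬∀⇒∃¬ ¬∀P = decidable-stable (anySubset? (λ z → ¬? (P? z))) (λ ∄¬P → ¬∀P (∄¬⇒∀ ∄¬P))

  family : Family N
  family a = ⌊ P? a ⌋

  ∈-family⁺ : P a → a ∈F family
  ∈-family⁺ {a} Pa with P? a
  ... | yes _ = refl
  ... | no ¬Pa = contradiction Pa ¬Pa

  ∈-family⁻ : a ∈F family → P a
  ∈-family⁻ {a} a∈ with P? a
  ∈-family⁻ a∈ | yes Pa = Pa
  ∈-family⁻ () | no _

⊈⇒∃∉ : ¬ p ⊆ z → ∃ λ i → i ∈ p × i ∉ z
⊈⇒∃∉ {N} {p} {z} p⊈z with ¬∀⟶∃¬ N _ (λ i → (i ∈? p) →-dec (i ∈? z)) (λ p⊆z → p⊈z (p⊆z _))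
... | i , i∈p⇏i∈z with i ∈? p
...   | yes i∈p = i , i∈p , λ i∈z → i∈p⇏i∈z (λ _ → i∈z)
...   | no i∉p = contradiction (λ i∈p → contradiction i∈p i∉p) i∈p⇏i∈z

∣p∪q∣≤∣p∣+∣q∣ : (p q : Subset N) → ∣ p ∪ q ∣ ≤ ∣ p ∣ + ∣ q ∣
∣p∪q∣≤∣p∣+∣q∣ [] [] = z≤n
∣p∪q∣≤∣p∣+∣q∣ (inside ∷ p) (inside ∷ q) = s≤s (≤-trans (∣p∪q∣≤∣p∣+∣q∣ p q) (+-monoʳ-≤ ∣ p ∣ (n≤1+n ∣ q ∣)))
∣p∪q∣≤∣p∣+∣q∣ (inside ∷ p) (outside ∷ q) = s≤s (∣p∪q∣≤∣p∣+∣q∣ p q)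
∣p∪q∣≤∣p∣+∣q∣ (outside ∷ p) (inside ∷ q) = subst (suc ∣ p ∪ q ∣ ≤_) (sym (+-suc ∣ p ∣ ∣ q ∣)) (s≤s (∣p∪q∣≤∣p∣+∣q∣ p q))
∣p∪q∣≤∣p∣+∣q∣ (outside ∷ p) (outside ∷ q) = ∣p∪q∣≤∣p∣+∣q∣ p q

InE-pair : (i j : Fin N) → ¬ i ≡ j → InE (⁅ i ⁆ ∪ ⁅ j ⁆)
InE-pair i j i≢j = ≤-antisym ∣pair∣≤2 2≤∣pair∣
  where
  ∣pair∣≤2 : ∣ ⁅ i ⁆ ∪ ⁅ j ⁆ ∣ ≤ 2
  ∣pair∣≤2 with ∣p∪q∣≤∣p∣+∣q∣ ⁅ i ⁆ ⁅ j ⁆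
  ... | bound rewrite ∣⁅x⁆∣≡1 i | ∣⁅x⁆∣≡1 j = bound

  ⁅i⁆⊂pair : ⁅ i ⁆ ⊂ ⁅ i ⁆ ∪ ⁅ j ⁆
  ⁅i⁆⊂pair = p⊆p∪q ⁅ j ⁆ , j , x∈p∪q⁺ (inj₂ (x∈⁅x⁆ j)) , λ j∈⁅i⁆ → i≢j (sym (x∈⁅y⁆⇒x≡y i j∈⁅i⁆))

  2≤∣pair∣ : 2 ≤ ∣ ⁅ i ⁆ ∪ ⁅ j ⁆ ∣
  2≤∣pair∣ = subst (λ k → suc k ≤ ∣ ⁅ i ⁆ ∪ ⁅ j ⁆ ∣) (∣⁅x⁆∣≡1 i) (p⊂q⇒∣p∣<∣q∣ ⁅i⁆⊂pair)

pair⊆ : {i j : Fin N} → i ∈ p → j ∈ p → ⁅ i ⁆ ∪ ⁅ j ⁆ ⊆ p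
pair⊆ {i = i} {j} i∈p j∈p x∈pair with x∈p∪q⁻ ⁅ i ⁆ ⁅ j ⁆ x∈pair
... | inj₁ x∈⁅i⁆ = subst (_∈ _) (sym (x∈⁅y⁆⇒x≡y i x∈⁅i⁆)) i∈p
... | inj₂ x∈⁅j⁆ = subst (_∈ _) (sym (x∈⁅y⁆⇒x≡y j x∈⁅j⁆)) j∈p

∃crossingEdge : ¬ p ⊆ z → ¬ p ⊆ ∁ z → ∃ λ e → InE e × e ⊆ p × ¬ e ⊆ z × ¬ e ⊆ ∁ z
∃crossingEdge {p = p} {z} p⊈z p⊈∁z with ⊈⇒∃∉ p⊈z | ⊈⇒∃∉ p⊈∁z
... | i , i∈p , i∉z | j , j∈p , j∉∁z =
  ⁅ i ⁆ ∪ ⁅ j ⁆ , InE-pair i j i≢j , pair⊆ i∈p j∈p ,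
  (λ e⊆z → i∉z (e⊆z (x∈p∪q⁺ (inj₁ (x∈⁅x⁆ i))))) ,
  (λ e⊆∁z → j∉∁z (e⊆∁z (x∈p∪q⁺ (inj₂ (x∈⁅x⁆ j)))))
  where
  i≢j : ¬ i ≡ j
  i≢j refl = i∉z (x∉∁p⇒x∈p j∉∁z)

InP-⊆⇒2≤∣∣ : InP a → a ⊆ s → 2 ≤ ∣ s ∣
InP-⊆⇒2≤∣∣ 2≤∣a∣ a⊆s = ≤-trans 2≤∣a∣ (p⊆q⇒∣p∣≤∣q∣ a⊆s)

InP⇒⊈∅ : InP a → ¬ a ⊆ ∅
InP⇒⊈∅ {N} a∈P a⊆∅ = contradiction (subst (2 ≤_) (∣⊥∣≡0 N) (InP-⊆⇒2≤∣∣ a∈P a⊆∅)) λ ()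

InP⇒⊈⁅x⁆ : {x : Fin N} → InP a → ¬ a ⊆ ⁅ x ⁆
InP⇒⊈⁅x⁆ {x = x} a∈P a⊆⁅x⁆ =
  contradiction (subst (2 ≤_) (∣⁅x⁆∣≡1 x) (InP-⊆⇒2≤∣∣ a∈P a⊆⁅x⁆)) λ { (s≤s ()) }

⊆-both-sides⇒⊆∅ : a ⊆ z → a ⊆ ∁ z → a ⊆ ∅
⊆-both-sides⇒⊆∅ a⊆z a⊆∁z x∈a = contradiction (a⊆z x∈a) (x∈∁p⇒x∉p (a⊆∁z x∈a))

↾⁻ : ∀ (A : Family N) z → a ∈F (A ↾ z) → a ∈F A × a ⊆ z
↾⁻ {a = a} A z a∈ with A a | a ⊆? z
↾⁻ A z a∈ | true | yes a⊆z = refl , a⊆z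
↾⁻ A z () | true | no _
↾⁻ A z () | false | _

↾⁺ : ∀ (A : Family N) z → a ∈F A → a ⊆ z → a ∈F (A ↾ z)
↾⁺ {a = a} A z a∈A a⊆z with a ⊆? z
... | yes _ rewrite a∈A = refl
... | no a⊈z = ⊥-elim (a⊈z a⊆z)

↾⊆F : ∀ (A : Family N) z → (A ↾ z) ⊆F A
↾⊆F A z a a∈ = proj₁ (↾⁻ A z a∈)

_⊑F_ : Family N → Family N → Set
E ⊑F A = ∀ p → p ∈F A → ∃ λ e → e ∈F E × e ⊆ p

⊆F⇒⊒F : A ⊆F B → B ⊑F A
⊆F⇒⊒F A⊆B p p∈A = p , A⊆B p p∈A , λ x∈p → x∈p

↾-⊑F : E ⊑F A → (E ↾ z) ⊑F (A ↾ z)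
↾-⊑F {E = E} {A} {z} E⊑A p p∈A↾z with ↾⁻ A z p∈A↾z
... | p∈A , p⊆z with E⊑A p p∈A
... | e , e∈E , e⊆p = e , ↾⁺ E z e∈E (λ x∈e → p⊆z (e⊆p x∈e)) , e⊆p

NormGE-⊑F : ∀ n → E ⊑F A → NormGE n A → NormGE n E
NormGE-⊑F zero E⊑A _ = tt
NormGE-⊑F (suc zero) E⊑A (a , a∈A) = proj₁ (E⊑A a a∈A) , proj₁ (proj₂ (E⊑A a a∈A))
NormGE-⊑F (suc (suc n)) E⊑A A≥n+2 z with A≥n+2 z
... | inj₁ A↾z≥ = inj₁ (NormGE-⊑F (suc n) (↾-⊑F E⊑A) A↾z≥)
... | inj₂ A↾∁z≥ = inj₂ (NormGE-⊑F (suc n) (↾-⊑F E⊑A) A↾∁z≥)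

NormGE-mono : ∀ n → A ⊆F B → NormGE n A → NormGE n B
NormGE-mono n A⊆B = NormGE-⊑F n (⊆F⇒⊒F A⊆B)

NormGE-pred : ∀ n → NormGE (suc n) A → NormGE n A
NormGE-pred zero _ = tt
NormGE-pred (suc n) A≥n+2 with A≥n+2 ∅
... | inj₁ A↾∅≥ = NormGE-mono (suc n) (↾⊆F _ ∅) A↾∅≥
... | inj₂ A↾∁∅≥ = NormGE-mono (suc n) (↾⊆F _ (∁ ∅)) A↾∁∅≥

NormGE-anti : m ≤ n → NormGE n A → NormGE m A
NormGE-anti m≤n = go (≤⇒≤′ m≤n)
  where
  go : m ≤′ n → NormGE n A → NormGE m A
  go (≤′-reflexive refl) A≥n = A≥n
  go (≤′-step {n} m≤′n) A≥n+1 = go m≤′n (NormGE-pred n A≥n+1)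

NormGE? : ∀ n (A : Family N) → Dec (NormGE n A)
NormGE? zero A = yes tt
NormGE? (suc zero) A = anySubset? (λ a → A a Bool.≟ true)
NormGE? (suc (suc n)) A = allSubset? λ z → NormGE? (suc n) (A ↾ z) ⊎-dec NormGE? (suc n) (A ↾ ∁ z)

¬NormGE-supported : (l : List (Fin N)) → FamSubP A → (∀ a → a ∈F A → ∀ {i} → i ∈ a → i ∈L l) →
  ¬ NormGE (2 + length l) A
¬NormGE-supported [] A⊆P A⊆l A≥2 with NormGE-anti (s≤s z≤n) A≥2
... | a , a∈A = InP⇒⊈∅ (A⊆P a a∈A) λ x∈a → contradiction (A⊆l a a∈A x∈a) λ ()
¬NormGE-supported {A = A} (i ∷ l) A⊆P A⊆l A≥ with A≥ ⁅ i ⁆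
... | inj₁ A↾⁅i⁆≥ with NormGE-anti (s≤s z≤n) A↾⁅i⁆≥
...   | a , a∈ = InP⇒⊈⁅x⁆ (A⊆P a (↾⊆F A ⁅ i ⁆ a a∈)) (proj₂ (↾⁻ A ⁅ i ⁆ a∈))
¬NormGE-supported {A = A} (i ∷ l) A⊆P A⊆l A≥ | inj₂ A↾∁⁅i⁆≥ =
  ¬NormGE-supported l (λ a a∈ → A⊆P a (↾⊆F A (∁ ⁅ i ⁆) a a∈)) avoids-i A↾∁⁅i⁆≥
  where
  avoids-i : ∀ a → a ∈F (A ↾ ∁ ⁅ i ⁆) → ∀ {j} → j ∈ a → j ∈L l
  avoids-i a a∈ j∈a with ↾⁻ A (∁ ⁅ i ⁆) a∈
  ... | a∈A , a⊆∁⁅i⁆ with A⊆l a a∈A j∈a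
  ... | here refl = contradiction (x∈⁅x⁆ i) (x∈∁p⇒x∉p (a⊆∁⁅i⁆ j∈a))
  ... | there j∈l = j∈l

∃NormIs : FamSubP A → ∃ λ n → NormIs A n
∃NormIs {N} {A} A⊆P = ∃-boundary (λ n → NormGE? n A) tt _
  (¬NormGE-supported (allFin N) A⊆P (λ _ _ {i} _ → ∈-allFin i))

InCalE-↾⇒⊆ : InCalE (A ↾ z) E → e ∈F E → e ⊆ z
InCalE-↾⇒⊆ {A = A} {z} (_ , E⊆A , _) e∈E with E⊆A _ e∈E
... | p , p∈A↾z , e⊆p = λ x∈e → proj₂ (↾⁻ A z p∈A↾z) (e⊆p x∈e)

InE⇒⊈both-sides : InE e → e ⊆ z → ¬ e ⊆ ∁ z
InE⇒⊈both-sides ∣e∣≡2 e⊆z e⊆∁z = InP⇒⊈∅ (≤-reflexive (sym ∣e∣≡2)) (⊆-both-sides⇒⊆∅ e⊆z e⊆∁z)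

module Glue (A : Family N) (z : Subset N) (E₁ E₂ : Family N) where

  Crossing : Subset N → Set
  Crossing e = InE e × ¬ e ⊆ z × ¬ e ⊆ ∁ z × ∃ λ p → p ∈F A × e ⊆ p

  crossing? : Decidable Crossing
  crossing? e = (∣ e ∣ ℕ.≟ 2) ×-dec ¬? (e ⊆? z) ×-dec ¬? (e ⊆? ∁ z)
    ×-dec anySubset? (λ p → (A p Bool.≟ true) ×-dec (e ⊆? p))

  Member : Subset N → Set
  Member e = e ∈F E₁ ⊎ e ∈F E₂ ⊎ Crossing e

  member? : Decidable Member
  member? e = (E₁ e Bool.≟ true) ⊎-dec (E₂ e Bool.≟ true) ⊎-dec crossing? e

  glued : Family N
  glued = family member?

  module _ (E₁∈𝓔 : InCalE (A ↾ z) E₁) (E₂∈𝓔 : InCalE (A ↾ ∁ z) E₂) where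

    glued∈𝓔 : InCalE A glued
    glued∈𝓔 = edges , coveredByA , glued⊑A
      where
      edges : FamSubE glued
      edges e e∈ with ∈-family⁻ member? e∈
      ... | inj₁ e∈E₁ = proj₁ E₁∈𝓔 e e∈E₁
      ... | inj₂ (inj₁ e∈E₂) = proj₁ E₂∈𝓔 e e∈E₂
      ... | inj₂ (inj₂ crossing) = proj₁ crossing

      fromRestriction : ∀ {w} → (∃ λ p → p ∈F (A ↾ w) × e ⊆ p) → ∃ λ p → p ∈F A × e ⊆ p
      fromRestriction {w = w} (p , p∈ , e⊆p) = p , ↾⊆F A w p p∈ , e⊆p

      coveredByA : ∀ e → e ∈F glued → ∃ λ p → p ∈F A × e ⊆ p
      coveredByA e e∈ with ∈-family⁻ member? e∈
      ... | inj₁ e∈E₁ = fromRestriction (proj₁ (proj₂ E₁∈𝓔) e e∈E₁)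
      ... | inj₂ (inj₁ e∈E₂) = fromRestriction (proj₁ (proj₂ E₂∈𝓔) e e∈E₂)
      ... | inj₂ (inj₂ crossing) = proj₂ (proj₂ (proj₂ crossing))

      glued⊑A : glued ⊑F A
      glued⊑A p p∈A with p ⊆? z | p ⊆? ∁ z
      ... | yes p⊆z | _ with proj₂ (proj₂ E₁∈𝓔) p (↾⁺ A z p∈A p⊆z)
      ...   | e , e∈E₁ , e⊆p = e , ∈-family⁺ member? (inj₁ e∈E₁) , e⊆p
      glued⊑A p p∈A | no _ | yes p⊆∁z with proj₂ (proj₂ E₂∈𝓔) p (↾⁺ A (∁ z) p∈A p⊆∁z)
      ...   | e , e∈E₂ , e⊆p = e , ∈-family⁺ member? (inj₂ (inj₁ e∈E₂)) , e⊆p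
      glued⊑A p p∈A | no p⊈z | no p⊈∁z with ∃crossingEdge p⊈z p⊈∁z
      ...   | e , e∈E , e⊆p , e⊈z , e⊈∁z =
        e , ∈-family⁺ member? (inj₂ (inj₂ (e∈E , e⊈z , e⊈∁z , p , p∈A , e⊆p))) , e⊆p

    glued↾z : (glued ↾ z) ⊆F E₁
    glued↾z e e∈ with ↾⁻ glued z e∈
    ... | e∈glued , e⊆z with ∈-family⁻ member? e∈glued
    ...   | inj₁ e∈E₁ = e∈E₁
    ...   | inj₂ (inj₁ e∈E₂) =
      ⊥-elim (InE⇒⊈both-sides (proj₁ E₂∈𝓔 e e∈E₂) e⊆z (InCalE-↾⇒⊆ E₂∈𝓔 e∈E₂))
    ...   | inj₂ (inj₂ crossing) = ⊥-elim (proj₁ (proj₂ crossing) e⊆z)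

    glued↾∁z : (glued ↾ ∁ z) ⊆F E₂
    glued↾∁z e e∈ with ↾⁻ glued (∁ z) e∈
    ... | e∈glued , e⊆∁z with ∈-family⁻ member? e∈glued
    ...   | inj₁ e∈E₁ =
      ⊥-elim (InE⇒⊈both-sides (proj₁ E₁∈𝓔 e e∈E₁) (InCalE-↾⇒⊆ E₁∈𝓔 e∈E₁) e⊆∁z)
    ...   | inj₂ (inj₁ e∈E₂) = e∈E₂
    ...   | inj₂ (inj₂ crossing) = ⊥-elim (proj₁ (proj₂ (proj₂ crossing)) e⊆∁z)

∃InCalE-¬NormGE : ∀ n (A : Family N) → ¬ NormGE (suc n) A → ∃ λ E → InCalE A E × ¬ NormGE (suc n) E
∃InCalE-¬NormGE zero A A≱1 = (λ _ → false) , ((λ _ ()) , (λ _ ()) , λ p p∈A → contradiction (p , p∈A) A≱1) , λ ()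
∃InCalE-¬NormGE (suc n) A A≱n+2 with ¬∀⇒∃¬ (λ z → NormGE? (suc n) (A ↾ z) ⊎-dec NormGE? (suc n) (A ↾ ∁ z)) A≱n+2
... | z , ¬splits
  with ∃InCalE-¬NormGE n (A ↾ z) (λ A↾z≥ → ¬splits (inj₁ A↾z≥))
     | ∃InCalE-¬NormGE n (A ↾ ∁ z) (λ A↾∁z≥ → ¬splits (inj₂ A↾∁z≥))
... | E₁ , E₁∈𝓔 , E₁≱ | E₂ , E₂∈𝓔 , E₂≱ = glued , glued∈𝓔 E₁∈𝓔 E₂∈𝓔 , glued≱
  where
  open Glue A z E₁ E₂

  glued≱ : ¬ NormGE (suc (suc n)) glued
  glued≱ glued≥ with glued≥ z
  ... | inj₁ ≥ = E₁≱ (NormGE-mono (suc n) (glued↾z E₁∈𝓔 E₂∈𝓔) ≥)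
  ... | inj₂ ≥ = E₂≱ (NormGE-mono (suc n) (glued↾∁z E₁∈𝓔 E₂∈𝓔) ≥)

mainTheorem9 : (N : ℕ) (A : Family N) → FamSubP A →
    Σ ℕ λ n → NormIs A n
    × (∃ λ E' → InCalE A E' × NormIs E' n)
    × (∀ E' → InCalE A E' → ∀ m → NormIs E' m → n ≤ m)
mainTheorem9 N A A⊆P with ∃NormIs A⊆P
... | n , A≥n , A≱n+1 with ∃InCalE-¬NormGE n A A≱n+1
... | E , E∈𝓔@(_ , _ , E⊑A) , E≱n+1 =
  n , (A≥n , A≱n+1) , (E , E∈𝓔 , (NormGE-⊑F n E⊑A A≥n , E≱n+1)) , minimal
  where
  minimal : ∀ E' → InCalE A E' → ∀ m → NormIs E' m → n ≤ m
  minimal E' (_ , _ , E'⊑A) m (_ , E'≱m+1) =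
    ≮⇒≥ λ m<n → E'≱m+1 (NormGE-anti m<n (NormGE-⊑F n E'⊑A A≥n))
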